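{- Let $N$ be a positive integer, $d\ge 2$, and let $a,p,m,k$ be nonzero integers such that $\gcd(m,p)=1$, $\gcd(ap,N)=1$ and $(am^d-kN)/p$ is a nonzero integer. Let $$\vec{c}=[c_0,\dots,c_d]=\left[ap^{d-1},ap^{d-2}m,\dots,am^{d-1},\frac{am^d-kN}{p}\right],$$ and define $\tilde{a}=a/\gcd(a,c_d)$ and $\tilde{k}=k/\gcd(a,c_d)$. Then for any degree $d$ polynomial $\tilde{f}\in\mathbb{Z}[x]$ with leading coefficient $\tilde{a}$ and $\tilde{f}(m/p)p^d=\tilde{k}N$, a vector $(a_0,\dots,a_d)\in\mathbb{Z}^{d+1}$ is orthogonal to $\vec{c}$ (for the standard inner product) if and only if there exist integers $r_0,\dots,r_{d-1}$ such that $$\sum_{i=0}^{d}a_ix^i=r_{d-1}\tilde{f}(x)+(px-m)\sum_{i=0}^{d-2}r_ix^i.$$ Moreover, such a polynomial $\tilde{f}$ exists and can be computed with Algorithm A.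
   Context: Algorithm A. Input: nonzero integers $m,p,\tilde{k},N$ with $\gcd(m,p)=1$, and integers $a_j,\dots,a_n$ with $1\le j\le n$ such that $p^{n-j+1}$ divides $\tilde{k}N-\sum_{i=j}^{n}a_im^ip^{n-i}$. Output: an integer polynomial $\tilde{f}=\sum_{i=0}^n a_ix^i$ with $\tilde{f}(m/p)p^n=\tilde{k}N$. Steps: (1) If $j=n$ set $r_j=\tilde{k}N$; otherwise set $r_j=\left(\tilde{k}N-\sum_{i=j+1}^{n}a_im^ip^{n-i}\right)/p^{n-j}$. (2) For $i=j-1,\dots,0$ compute $r_i=(r_{i+1}-a_{i+1}m^{i+1})/p$ and $a_i=(r_i+t_ip)/m^i$, where $t_i\in[-m^i/2,m^i/2)\cap\mathbb{Z}$ satisfies $t_i\equiv -r_i/p\pmod{m^i}$. (3) Return $\tilde{f}=\sum_{i=0}^n a_ix^i$. -}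

module Defs where

open import Data.Nat as ℕ using (ℕ; zero; suc; _∸_; _<ᵇ_; _≡ᵇ_)
open import Data.Bool using (if_then_else_)
open import Data.Fin using (Fin; toℕ; fromℕ<)
open import Data.Integer using (ℤ; +_; -_; _+_; _-_; _*_; _^_; _≤_; _<_; ∣_∣; 0ℤ)
open import Data.Integer.Divisibility using (_∣_)
open import Data.Product using (_×_)
open import Relation.Binary.PropositionalEquality using (_≡_)
open import Relation.Nullary using (yes; no)

-- Integer polynomials, represented by their coefficient sequence
-- (coefficient of x^i at index i).  Finite support is imposed where needed.
Poly : Set
Poly = ℕ → ℤ

Σ< : ℕ → (ℕ → ℤ) → ℤ
Σ< zero    f = 0ℤ
Σ< (suc n) f = Σ< n f + f n

-- Σ_{i = lo}^{hi} f i   (empty when hi < lo)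
ΣRange : ℕ → ℕ → (ℕ → ℤ) → ℤ
ΣRange lo hi f = Σ< (suc hi ∸ lo) (λ l → f (lo ℕ.+ l))

_≈P_ : Poly → Poly → Set
f ≈P g = ∀ i → f i ≡ g i

_⊕_ : Poly → Poly → Poly
(f ⊕ g) i = f i + g i

_·P_ : ℤ → Poly → Poly
(c ·P f) i = c * f i

_⊗_ : Poly → Poly → Poly
(f ⊗ g) n = Σ< (suc n) (λ i → f i * g (n ∸ i))

linP : ℤ → ℤ → Poly
linP p m zero          = - m
linP p m (suc zero)    = p
linP p m (suc (suc _)) = 0ℤ

truncP : ℕ → (ℕ → ℤ) → Poly
truncP n r i = if i <ᵇ n then r i else 0ℤ

vecP : ∀ {n} → (Fin n → ℤ) → Poly
vecP {n} v i with i ℕ.<? n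
... | yes i<n = v (fromℕ< i<n)
... | no  _   = 0ℤ

-- f is a polynomial of degree d with leading coefficient c
-- (c ≠ 0 is ensured separately)
DegLead : ℕ → ℤ → Poly → Set
DegLead d c f = (f d ≡ c) × (∀ i → d ℕ.< i → f i ≡ 0ℤ)

-- f(m/p) p^d  for a polynomial f of degree ≤ d
homEval : ℕ → Poly → ℤ → ℤ → ℤ
homEval d f m p = Σ< (suc d) (λ i → f i * m ^ i * p ^ (d ∸ i))

cVec : ℕ → ℤ → ℤ → ℤ → ℤ → ℕ → ℤ
cVec d a p m cd i = if i ≡ᵇ d then cd else a * p ^ (d ∸ 1 ∸ i) * m ^ i

Orthogonal : (d : ℕ) → (Fin (suc d) → ℤ) → (ℕ → ℤ) → Set
Orthogonal d v c = Σ< (suc d) (λ i → vecP v i * c i) ≡ 0ℤ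

-- A (complete) run of Algorithm A on input m, p, K = k̃N, n, j and
-- prescribed top coefficients a_j, …, a_n (given by `pre`).
-- Fields follow the steps of the algorithm; `out` is the returned f̃.
-- READING: t_i ∈ [-m^i/2, m^i/2) is read with |m^i| (symmetric residues).
record AlgARun (m p K : ℤ) (n j : ℕ) (pre : ℕ → ℤ) : Set where
  field
    r t out   : ℕ → ℤ
    out-pre   : ∀ i → j ℕ.≤ i → i ℕ.≤ n → out i ≡ pre i
    out-high  : ∀ i → n ℕ.< i → out i ≡ 0ℤ
    step1     : p ^ (n ∸ j) * r j
                  ≡ K - ΣRange (suc j) n (λ i → pre i * m ^ i * p ^ (n ∸ i))
    step2-r   : ∀ i → i ℕ.< j → p * r i ≡ r (suc i) - out (suc i) * m ^ suc i
    step2-tlo : ∀ i → i ℕ.< j → - (+ ∣ m ^ i ∣) ≤ + 2 * t i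
    step2-thi : ∀ i → i ℕ.< j → + 2 * t i < + ∣ m ^ i ∣
    step2-tcg : ∀ i → i ℕ.< j → m ^ i ∣ r i + t i * p
    step2-a   : ∀ i → i ℕ.< j → m ^ i * out i ≡ r i + t i * p

-- Write H_n(g) = Σ_{i ≤ n} g_i m^i p^(n-i) for the homogenised value p^n g(m/p), and D = d - 1.
-- Then ⟨v, c⟩ = a H_D(v) + v_d c_d, and the hypotheses on f̃ make f̃ itself orthogonal to c.
-- Since H_D((px - m) q) = -m^d q_D vanishes when deg q < D, every r_D f̃ + (px - m) q is orthogonal
-- to c. Conversely, if v ⊥ c then, after dividing by gcd(a, c_d), ã divides c̃ v_d with
-- gcd(ã, c̃) = 1, so v_d = ρ ã; then w = v - ρ f̃ has degree < d and H_D(w) = 0, and because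
-- gcd(m, p) = 1 a downward induction gives m^(n+1) ∣ H_n(w), whence w = (px - m) q with
-- q_n = -H_n(w) / m^(n+1). Algorithm A runs the same recursion H_(i+1) = p H_i + a_(i+1) m^(i+1)
-- downwards: its remainders are r_i = H_i(f̃), and each a_i exists because p is invertible mod m^i.

module Submission where

open import Defs
open import Data.Nat using (ℕ; _≤_; _<_)
open import Data.Fin using (Fin)
open import Data.Integer using (ℤ; +_; _-_; _*_; _^_)
open import Data.Integer.GCD using (gcd)
open import Data.Product using (_×_; ∃)
open import Function.Bundles using (_⇔_)
open import Relation.Binary.PropositionalEquality using (_≡_; _≢_)

open import Data.Nat using (zero; suc; _∸_; _<ᵇ_; z≤n; s≤s)
import Data.Nat as ℕ
import Data.Nat.Properties as ℕP
import Data.Nat.GCD as ℕGCD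
open ℕGCD.Bézout using (+-; -+)
open import Data.Integer
  using (+[1+_]; -[1+_]; -_; _+_; ∣_∣; 0ℤ; 1ℤ; -1ℤ; +<+; +≤+; -≤-; ≢-nonZero)
import Data.Integer as ℤ
import Data.Integer.Properties as ℤP
open import Algebra.Properties.AbelianGroup ℤP.+-0-abelianGroup using ()
  renaming (∙-cancelˡ to +-cancelˡ-≡)
open import Data.Integer.DivMod using (_%ℕ_; _/ℕ_; a≡a%ℕn+[a/ℕn]*n; n%ℕd<d)
open import Data.Integer.Divisibility.Signed
  using ( _∣_; divides; quotient; ∣⇒∣ᵤ; ∣ᵤ⇒∣; ∣-refl; ∣-trans; m∣∣m∣
        ; ∣m∣n⇒∣m-n; ∣m⇒∣m*n; ∣n⇒∣m*n; ∣m+n∣n⇒∣m)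
open import Data.Integer.GCD using (gcd[i,j]∣j; gcd[i,j]≡0⇒i≡0)
open import Data.Integer.Tactic.RingSolver using (solve-∀)
open import Data.Product using (_,_; ∃₂; proj₁; proj₂)
open import Data.Sum using (inj₁; inj₂)
open import Data.Bool using (true; false; if_then_else_)
open import Function.Base using (_∘_)
open import Function.Bundles using (mk⇔; Equivalence)
open import Relation.Binary.PropositionalEquality
  using (refl; sym; trans; cong; cong₂; subst; subst₂; module ≡-Reasoning)
open import Relation.Nullary using (yes; no)
open import Relation.Nullary.Reflects using (Reflects; ofʸ; ofⁿ; fromEquivalence)
open import Relation.Nullary.Negation using (contradiction)

Comaximal : ℤ → ℤ → Set
Comaximal i j = ∃₂ λ x y → x * i + y * j ≡ 1ℤ

∃unit*i≡∣i∣ : ∀ i → ∃ λ u → u * i ≡ + ∣ i ∣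
∃unit*i≡∣i∣ (+ n)    = 1ℤ , ℤP.*-identityˡ (+ n)
∃unit*i≡∣i∣ -[1+ n ] = -1ℤ , ℤP.-1*i≡-i -[1+ n ]

bézout-from-ℕ : ∀ i j {g} x y → g ℕ.+ y ℕ.* ∣ j ∣ ≡ x ℕ.* ∣ i ∣ →
                ∃₂ λ s t → s * i + t * j ≡ + g
bézout-from-ℕ i j {g} x y eq with ∃unit*i≡∣i∣ i | ∃unit*i≡∣i∣ j
... | u , ui | v , vj = + x * u , - (+ y * v) , (begin
  + x * u * i + - (+ y * v) * j     ≡⟨ regroup (+ x) u i (+ y) v j ⟩
  + x * (u * i) - + y * (v * j)     ≡⟨ cong₂ (λ a b → + x * a - + y * b) ui vj ⟩
  + x * + ∣ i ∣ - + y * + ∣ j ∣     ≡⟨ cong₂ _-_ (ℤP.pos-* x ∣ i ∣) (ℤP.pos-* y ∣ j ∣) ⟨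
  + (x ℕ.* ∣ i ∣) - + (y ℕ.* ∣ j ∣) ≡⟨ cong (λ n → + n - + (y ℕ.* ∣ j ∣)) eq ⟨
  + (g ℕ.+ y ℕ.* ∣ j ∣) - + (y ℕ.* ∣ j ∣) ≡⟨ cong (_- + (y ℕ.* ∣ j ∣)) (ℤP.pos-+ g _) ⟩
  + g + + (y ℕ.* ∣ j ∣) - + (y ℕ.* ∣ j ∣) ≡⟨ cancel (+ g) (+ (y ℕ.* ∣ j ∣)) ⟩
  + g                               ∎)
  where
  open ≡-Reasoning
  regroup : ∀ x u i y v j → x * u * i + - (y * v) * j ≡ x * (u * i) - y * (v * j)
  regroup = solve-∀
  cancel : ∀ a b → a + b - b ≡ a
  cancel = solve-∀

gcd-bézout : ∀ i j → ∃₂ λ x y → x * i + y * j ≡ gcd i j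
gcd-bézout i j with ℕGCD.Bézout.identity (ℕGCD.gcd-GCD ∣ i ∣ ∣ j ∣)
... | +- x y eq = bézout-from-ℕ i j x y eq
... | -+ x y eq with bézout-from-ℕ j i y x eq
...   | s , t , e = t , s , trans (ℤP.+-comm (t * i) (s * j)) e

gcd≡1⇒comaximal : ∀ {i j} → gcd i j ≡ 1ℤ → Comaximal i j
gcd≡1⇒comaximal {i} {j} gcd≡1 with gcd-bézout i j
... | x , y , e = x , y , trans e gcd≡1

cofactors-comaximal : ∀ ĩ j̃ {i j} → gcd i j ≢ 0ℤ →
                      gcd i j * ĩ ≡ i → gcd i j * j̃ ≡ j → Comaximal ĩ j̃
cofactors-comaximal ĩ j̃ {i} {j} g≢0 gĩ gj̃ with gcd-bézout i j
... | x , y , e = x , y , ℤP.*-cancelˡ-≡ g _ _ {{≢-nonZero g≢0}} (begin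
  g * (x * ĩ + y * j̃)       ≡⟨ distribute g x ĩ y j̃ ⟩
  x * (g * ĩ) + y * (g * j̃) ≡⟨ cong₂ (λ a b → x * a + y * b) gĩ gj̃ ⟩
  x * i + y * j             ≡⟨ e ⟩
  g                         ≡⟨ ℤP.*-identityʳ g ⟨
  g * 1ℤ                    ∎)
  where
  open ≡-Reasoning
  g = gcd i j
  distribute : ∀ g x a y b → g * (x * a + y * b) ≡ x * (g * a) + y * (g * b)
  distribute = solve-∀

gcd-cofactorʳ : ∀ i j → ∃ λ j̃ → gcd i j * j̃ ≡ j
gcd-cofactorʳ i j = quotient g∣j , trans (ℤP.*-comm (gcd i j) (quotient g∣j)) (sym (_∣_.equality g∣j))
  where
  g∣j : gcd i j ∣ j
  g∣j = ∣ᵤ⇒∣ {gcd i j} {j} (gcd[i,j]∣j i j)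

comaximal-^ : ∀ {i j} → Comaximal i j → ∀ n → Comaximal (i ^ n) j
comaximal-^ {i} {j} _ zero = 1ℤ , 0ℤ , unit j
  where
  unit : ∀ j → 1ℤ * 1ℤ + 0ℤ * j ≡ 1ℤ
  unit = solve-∀
comaximal-^ {i} {j} c@(x , y , e) (suc n) with comaximal-^ c n
... | u , v , e′ = u * x , u * i ^ n * y + v , (begin
  u * x * (i * i ^ n) + (u * i ^ n * y + v) * j ≡⟨ regroup u x i (i ^ n) y v j ⟩
  u * i ^ n * (x * i + y * j) + v * j         ≡⟨ cong (λ z → u * i ^ n * z + v * j) e ⟩
  u * i ^ n * 1ℤ + v * j                      ≡⟨ cong (_+ v * j) (ℤP.*-identityʳ (u * i ^ n)) ⟩
  u * i ^ n + v * j                           ≡⟨ e′ ⟩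
  1ℤ                                          ∎)
  where
  open ≡-Reasoning
  regroup : ∀ u x i iⁿ y v j →
            u * x * (i * iⁿ) + (u * iⁿ * y + v) * j ≡ u * iⁿ * (x * i + y * j) + v * j
  regroup = solve-∀

comaximal-divisor : ∀ {i j k} → Comaximal i j → i ∣ j * k → i ∣ k
comaximal-divisor {i} {j} {k} (x , y , e) (divides q jk≡qi) = divides (x * k + y * q) (begin
  k                         ≡⟨ ℤP.*-identityˡ k ⟨
  1ℤ * k                    ≡⟨ cong (_* k) e ⟨
  (x * i + y * j) * k       ≡⟨ expand x i y j k ⟩
  x * k * i + y * (j * k)   ≡⟨ cong (λ z → x * k * i + y * z) jk≡qi ⟩
  x * k * i + y * (q * i)   ≡⟨ collect x k i y q ⟩
  (x * k + y * q) * i       ∎)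
  where
  open ≡-Reasoning
  expand : ∀ x i y j k → (x * i + y * j) * k ≡ x * k * i + y * (j * k)
  expand = solve-∀
  collect : ∀ x k i y q → x * k * i + y * (q * i) ≡ (x * k + y * q) * i
  collect = solve-∀

comaximal-cofactor-∣ : ∀ ĩ j̃ x y {g i j} → g ≢ 0ℤ → g * ĩ ≡ i → g * j̃ ≡ j → Comaximal ĩ j̃ →
                       i * x + y * j ≡ 0ℤ → ĩ ∣ y
comaximal-cofactor-∣ ĩ j̃ x y {g} {i} {j} g≢0 gĩ gj̃ coprime ix+yj≡0 =
  comaximal-divisor coprime (divides (- x) (begin
    j̃ * y                     ≡⟨ isolate ĩ x y j̃ ⟩
    - x * ĩ + (ĩ * x + y * j̃) ≡⟨ cong (λ z → - x * ĩ + z) reduced ⟩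
    - x * ĩ + 0ℤ              ≡⟨ ℤP.+-identityʳ (- x * ĩ) ⟩
    - x * ĩ                   ∎))
  where
  open ≡-Reasoning
  isolate : ∀ ĩ x y j̃ → j̃ * y ≡ - x * ĩ + (ĩ * x + y * j̃)
  isolate = solve-∀
  distribute : ∀ g ĩ x y j̃ → g * (ĩ * x + y * j̃) ≡ (g * ĩ) * x + y * (g * j̃)
  distribute = solve-∀
  reduced : ĩ * x + y * j̃ ≡ 0ℤ
  reduced = ℤP.*-cancelˡ-≡ g _ _ {{≢-nonZero g≢0}} (begin
    g * (ĩ * x + y * j̃)       ≡⟨ distribute g ĩ x y j̃ ⟩
    (g * ĩ) * x + y * (g * j̃) ≡⟨ cong₂ (λ u v → u * x + y * v) gĩ gj̃ ⟩
    i * x + y * j             ≡⟨ ix+yj≡0 ⟩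
    0ℤ                        ≡⟨ ℤP.*-zeroʳ g ⟨
    g * 0ℤ                    ∎)

divide-common-factor : ∀ p c̃ ã k̃ M N {g cd a k} → g ≢ 0ℤ →
                       g * c̃ ≡ cd → g * ã ≡ a → g * k̃ ≡ k →
                       p * cd ≡ a * M - k * N → p * - c̃ ≡ k̃ * N - ã * M
divide-common-factor p c̃ ã k̃ M N {g} {cd} {a} {k} g≢0 gc̃ gã gk̃ pcd =
  ℤP.*-cancelˡ-≡ g _ _ {{≢-nonZero g≢0}} (begin
    g * (p * - c̃)             ≡⟨ regroup g p c̃ ⟩
    - (p * (g * c̃))           ≡⟨ cong (λ x → - (p * x)) gc̃ ⟩
    - (p * cd)                ≡⟨ cong -_ pcd ⟩
    - (a * M - k * N)         ≡⟨ cong₂ (λ x y → - (x * M - y * N)) gã gk̃ ⟨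
    - (g * ã * M - g * k̃ * N) ≡⟨ factor g ã M k̃ N ⟩
    g * (k̃ * N - ã * M)       ∎)
  where
  open ≡-Reasoning
  regroup : ∀ g p c̃ → g * (p * - c̃) ≡ - (p * (g * c̃))
  regroup = solve-∀
  factor : ∀ g ã M k̃ N → - (g * ã * M - g * k̃ * N) ≡ g * (k̃ * N - ã * M)
  factor = solve-∀

comaximal-solve : ∀ {i j} → Comaximal i j → ∀ r → ∃ λ t → i ∣ r + t * j
comaximal-solve {i} {j} (x , y , e) r = - (r * y) , divides (r * x) (begin
  r + - (r * y) * j               ≡⟨ cong (_+ - (r * y) * j) (ℤP.*-identityʳ r) ⟨
  r * 1ℤ + - (r * y) * j          ≡⟨ cong (λ z → r * z + - (r * y) * j) e ⟨
  r * (x * i + y * j) + - (r * y) * j ≡⟨ simplify r x i y j ⟩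
  r * x * i                       ∎)
  where
  open ≡-Reasoning
  simplify : ∀ r x i y j → r * (x * i + y * j) + - (r * y) * j ≡ r * x * i
  simplify = solve-∀

Balanced : ℤ → ℤ → Set
Balanced M t = (- (+ ∣ M ∣) ℤ.≤ + 2 * t) × (+ 2 * t ℤ.< + ∣ M ∣)

symmetric-residue : ∀ K .{{_ : ℕ.NonZero K}} t →
                    ∃ λ s → Balanced (+ K) s × (+ K ∣ t - s)
symmetric-residue K t = balance (t %ℕ K) (t /ℕ K) (n%ℕd<d t K) (a≡a%ℕn+[a/ℕn]*n t K)
  where
  balance : ∀ ρ Q → ρ < K → t ≡ + ρ + Q * + K →
            ∃ λ s → Balanced (+ K) s × (+ K ∣ t - s)
  balance ρ Q ρ<K t≡ρ+QK with 2 ℕ.* ρ ℕ.<? K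
  ... | yes 2ρ<K = + ρ , (lower , upper) , divides Q (begin
    t - + ρ               ≡⟨ cong (_- + ρ) t≡ρ+QK ⟩
    + ρ + Q * + K - + ρ   ≡⟨ cancel (+ ρ) Q (+ K) ⟩
    Q * + K               ∎)
    where
    open ≡-Reasoning
    cancel : ∀ ρ Q K → ρ + Q * K - ρ ≡ Q * K
    cancel = solve-∀
    lower : - (+ K) ℤ.≤ + 2 * + ρ
    lower = subst (- (+ K) ℤ.≤_) (ℤP.pos-* 2 ρ) ℤP.neg-≤-pos
    upper : + 2 * + ρ ℤ.< + K
    upper = subst (ℤ._< + K) (ℤP.pos-* 2 ρ) (+<+ 2ρ<K)
  ... | no 2ρ≮K = + ρ - + K , (lower , upper) ,
    divides (Q + 1ℤ) (trans (cong (_- (+ ρ - + K)) t≡ρ+QK) (cancel (+ ρ) Q (+ K)))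
    where
    cancel : ∀ ρ Q K → ρ + Q * K - (ρ - K) ≡ (Q + 1ℤ) * K
    cancel = solve-∀
    double : ∀ ρ K → + 2 * (ρ - K) ≡ + 2 * ρ - + 2 * K
    double = solve-∀
    K≤2ρ : + K ℤ.≤ + 2 * + ρ
    K≤2ρ = subst (+ K ℤ.≤_) (ℤP.pos-* 2 ρ) (+≤+ (ℕP.≮⇒≥ 2ρ≮K))
    2ρ<3K : + 2 * + ρ ℤ.< + 3 * + K
    2ρ<3K = subst₂ ℤ._<_ (ℤP.pos-* 2 ρ) (ℤP.pos-* 3 K)
              (+<+ (ℕP.<-≤-trans (ℕP.*-monoʳ-< 2 ρ<K) (ℕP.*-monoˡ-≤ K (ℕP.n≤1+n 2))))
    lower : - (+ K) ℤ.≤ + 2 * (+ ρ - + K)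
    lower = begin
      - (+ K)               ≡⟨ negate (+ K) ⟩
      + K - + 2 * + K       ≤⟨ ℤP.+-monoˡ-≤ (- (+ 2 * + K)) K≤2ρ ⟩
      + 2 * + ρ - + 2 * + K ≡⟨ double (+ ρ) (+ K) ⟨
      + 2 * (+ ρ - + K)     ∎
      where
      open ℤP.≤-Reasoning
      negate : ∀ K → - K ≡ K - + 2 * K
      negate = solve-∀
    upper : + 2 * (+ ρ - + K) ℤ.< + K
    upper = begin-strict
      + 2 * (+ ρ - + K)     ≡⟨ double (+ ρ) (+ K) ⟩
      + 2 * + ρ - + 2 * + K <⟨ ℤP.+-monoˡ-< (- (+ 2 * + K)) 2ρ<3K ⟩
      + 3 * + K - + 2 * + K ≡⟨ difference (+ K) ⟩
      + K                   ∎
      where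
      open ℤP.≤-Reasoning
      difference : ∀ K → + 3 * K - + 2 * K ≡ K
      difference = solve-∀

comaximal-balanced-solve : ∀ {i j} → Comaximal i j → i ≢ 0ℤ → ∀ r →
                           ∃ λ t → Balanced i t × i ∣ r + t * j
comaximal-balanced-solve {i} {j} c i≢0 r with comaximal-solve c r
... | t , i∣r+tj with symmetric-residue ∣ i ∣ {{≢-nonZero i≢0}} t
...   | s , balanced , ∣i∣∣t-s = s , balanced ,
  subst (i ∣_) (shift r t s j) (∣m∣n⇒∣m-n i∣r+tj (∣m⇒∣m*n j (∣-trans m∣∣m∣ ∣i∣∣t-s)))
  where
  shift : ∀ r t s j → r + t * j - (t - s) * j ≡ r + s * j
  shift = solve-∀

^≢0 : ∀ {i} → i ≢ 0ℤ → ∀ n → i ^ n ≢ 0ℤ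
^≢0 i≢0 zero    ()
^≢0 {i} i≢0 (suc n) iⁿ⁺¹≡0 with ℤP.i*j≡0⇒i≡0∨j≡0 i iⁿ⁺¹≡0
... | inj₁ i≡0  = i≢0 i≡0
... | inj₂ iⁿ≡0 = ^≢0 i≢0 n iⁿ≡0

Σ<-cong : ∀ n {f g : ℕ → ℤ} → (∀ i → i < n → f i ≡ g i) → Σ< n f ≡ Σ< n g
Σ<-cong zero    _   = refl
Σ<-cong (suc n) f≡g =
  cong₂ _+_ (Σ<-cong n (λ i i<n → f≡g i (ℕP.m<n⇒m<1+n i<n))) (f≡g n (ℕP.n<1+n n))

Σ<-distribˡ : ∀ n c (f : ℕ → ℤ) → Σ< n (λ i → c * f i) ≡ c * Σ< n f
Σ<-distribˡ zero    c f = sym (ℤP.*-zeroʳ c)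
Σ<-distribˡ (suc n) c f =
  trans (cong (_+ c * f n) (Σ<-distribˡ n c f)) (sym (ℤP.*-distribˡ-+ c (Σ< n f) (f n)))

Σ<-two-terms : ∀ n (f : ℕ → ℤ) → (∀ j → f (2 ℕ.+ j) ≡ 0ℤ) → Σ< (2 ℕ.+ n) f ≡ f 0 + f 1
Σ<-two-terms zero    f _      = cong (_+ f 1) (ℤP.+-identityˡ (f 0))
Σ<-two-terms (suc n) f f₂₊≡0 =
  trans (cong (λ x → Σ< (2 ℕ.+ n) f + x) (f₂₊≡0 n))
        (trans (ℤP.+-identityʳ _) (Σ<-two-terms n f f₂₊≡0))

≡ᵇ-reflects-≡ : ∀ m n → Reflects (m ≡ n) (m ℕ.≡ᵇ n)
≡ᵇ-reflects-≡ m n = fromEquivalence (ℕP.≡ᵇ⇒≡ m n) (ℕP.≡⇒≡ᵇ m n)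

truncP-< : ∀ D q i → i < D → truncP D q i ≡ q i
truncP-< D q i i<D with i <ᵇ D | ℕP.<ᵇ-reflects-< i D
... | true  | _       = refl
... | false | ofⁿ i≮D = contradiction i<D i≮D

truncP-≥ : ∀ D q i → D ≤ i → truncP D q i ≡ 0ℤ
truncP-≥ D q i D≤i with i <ᵇ D | ℕP.<ᵇ-reflects-< i D
... | true  | ofʸ i<D = contradiction i<D (ℕP.≤⇒≯ D≤i)
... | false | _       = refl

withTop : ℕ → (ℕ → ℤ) → ℤ → ℕ → ℤ
withTop D q ρ n = if n <ᵇ D then q n else ρ

withTop-< : ∀ D q ρ i → i < D → withTop D q ρ i ≡ q i
withTop-< D q ρ i i<D with i <ᵇ D | ℕP.<ᵇ-reflects-< i D
... | true  | _       = refl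
... | false | ofⁿ i≮D = contradiction i<D i≮D

withTop-top : ∀ D q ρ → withTop D q ρ D ≡ ρ
withTop-top D q ρ with D <ᵇ D | ℕP.<ᵇ-reflects-< D D
... | true  | ofʸ D<D = contradiction D<D (ℕP.n≮n D)
... | false | _       = refl

truncP-withTop : ∀ D q ρ → truncP D (withTop D q ρ) ≈P truncP D q
truncP-withTop D q ρ i with i <ᵇ D
... | true  = refl
... | false = refl

⊗-congʳ : ∀ f {g h} → g ≈P h → (f ⊗ g) ≈P (f ⊗ h)
⊗-congʳ f g≈h n = Σ<-cong (suc n) (λ i _ → cong (f i *_) (g≈h (n ∸ i)))

vecP-≥ : ∀ {n} (v : Fin n → ℤ) i → n ≤ i → vecP v i ≡ 0ℤ
vecP-≥ {n} v i n≤i with i ℕ.<? n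
... | yes i<n = contradiction i<n (ℕP.≤⇒≯ n≤i)
... | no  _   = refl

module HomogeneousEvaluation (m p : ℤ) where

  open ≡-Reasoning

  homEval-zero : ∀ g → homEval 0 g m p ≡ g 0
  homEval-zero g = unit (g 0)
    where
    unit : ∀ x → 0ℤ + x * 1ℤ * 1ℤ ≡ x
    unit = solve-∀

  homEval-suc : ∀ n g → homEval (suc n) g m p ≡ p * homEval n g m p + g (suc n) * m ^ suc n
  homEval-suc n g = cong₂ _+_ lower top
    where
    term : ℕ → ℤ
    term i = g i * m ^ i * p ^ (n ∸ i)
    factor-p : ∀ x y p q → x * y * (p * q) ≡ p * (x * y * q)
    factor-p = solve-∀
    lower : Σ< (suc n) (λ i → g i * m ^ i * p ^ (suc n ∸ i)) ≡ p * homEval n g m p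
    lower = begin
      Σ< (suc n) (λ i → g i * m ^ i * p ^ (suc n ∸ i)) ≡⟨ Σ<-cong (suc n) shift ⟩
      Σ< (suc n) (λ i → p * term i)                     ≡⟨ Σ<-distribˡ (suc n) p term ⟩
      p * homEval n g m p                               ∎
      where
      shift : ∀ i → i < suc n → g i * m ^ i * p ^ (suc n ∸ i) ≡ p * term i
      shift i (s≤s i≤n) = trans (cong (λ e → g i * m ^ i * p ^ e) (ℕP.+-∸-assoc 1 i≤n))
                                (factor-p (g i) (m ^ i) p (p ^ (n ∸ i)))
    top : g (suc n) * m ^ suc n * p ^ (n ∸ n) ≡ g (suc n) * m ^ suc n
    top = trans (cong (λ e → g (suc n) * m ^ suc n * p ^ e) (ℕP.n∸n≡0 n))
                (ℤP.*-identityʳ _)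

  homEval-cong : ∀ n {f g} → f ≈P g → homEval n f m p ≡ homEval n g m p
  homEval-cong n f≈g = Σ<-cong (suc n) (λ i _ → cong (λ x → x * m ^ i * p ^ (n ∸ i)) (f≈g i))

  homEval-linear : ∀ n c f g → homEval n ((c ·P f) ⊕ g) m p ≡ c * homEval n f m p + homEval n g m p
  homEval-linear zero c f g = begin
    homEval 0 ((c ·P f) ⊕ g) m p         ≡⟨ homEval-zero ((c ·P f) ⊕ g) ⟩
    c * f 0 + g 0                        ≡⟨ cong₂ (λ x y → c * x + y) (homEval-zero f) (homEval-zero g) ⟨
    c * homEval 0 f m p + homEval 0 g m p ∎
  homEval-linear (suc n) c f g = begin
    homEval (suc n) ((c ·P f) ⊕ g) m p
      ≡⟨ homEval-suc n ((c ·P f) ⊕ g) ⟩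
    p * homEval n ((c ·P f) ⊕ g) m p + (c * f (suc n) + g (suc n)) * m ^ suc n
      ≡⟨ cong (λ x → p * x + (c * f (suc n) + g (suc n)) * m ^ suc n) (homEval-linear n c f g) ⟩
    p * (c * homEval n f m p + homEval n g m p) + (c * f (suc n) + g (suc n)) * m ^ suc n
      ≡⟨ regroup p c (homEval n f m p) (homEval n g m p) (f (suc n)) (g (suc n)) (m ^ suc n) ⟩
    c * (p * homEval n f m p + f (suc n) * m ^ suc n) + (p * homEval n g m p + g (suc n) * m ^ suc n)
      ≡⟨ cong₂ (λ x y → c * x + y) (homEval-suc n f) (homEval-suc n g) ⟨
    c * homEval (suc n) f m p + homEval (suc n) g m p
      ∎
    where
    regroup : ∀ p c x y u v M →
              p * (c * x + y) + (c * u + v) * M ≡ c * (p * x + u * M) + (p * y + v * M)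
    regroup = solve-∀

  homEval-injective : m ≢ 0ℤ → ∀ {D f g} →
                      (∀ n → n ≤ D → homEval n f m p ≡ homEval n g m p) →
                      ∀ n → n ≤ D → f n ≡ g n
  homEval-injective _ {f = f} {g} agree zero 0≤D =
    trans (sym (homEval-zero f)) (trans (agree 0 0≤D) (homEval-zero g))
  homEval-injective m≢0 {f = f} {g} agree (suc n) n<D =
    ℤP.*-cancelʳ-≡ (f (suc n)) (g (suc n)) (m ^ suc n) {{≢-nonZero (^≢0 m≢0 (suc n))}}
      (+-cancelˡ-≡ (p * homEval n f m p) _ _ (begin
        p * homEval n f m p + f (suc n) * m ^ suc n ≡⟨ homEval-suc n f ⟨
        homEval (suc n) f m p                      ≡⟨ agree (suc n) n<D ⟩
        homEval (suc n) g m p                      ≡⟨ homEval-suc n g ⟩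
        p * homEval n g m p + g (suc n) * m ^ suc n
          ≡⟨ cong (λ x → p * x + g (suc n) * m ^ suc n) (agree n (ℕP.<⇒≤ n<D)) ⟨
        p * homEval n f m p + g (suc n) * m ^ suc n ∎))

  linP⊗-zero : ∀ q → (linP p m ⊗ q) 0 ≡ - m * q 0
  linP⊗-zero q = ℤP.+-identityˡ (- m * q 0)

  linP⊗-suc : ∀ q n → (linP p m ⊗ q) (suc n) ≡ - m * q (suc n) + p * q n
  linP⊗-suc q n = Σ<-two-terms n _ (λ _ → refl)

  homEval-linP⊗ : ∀ n q → homEval n (linP p m ⊗ q) m p ≡ - (m ^ suc n * q n)
  homEval-linP⊗ zero q = begin
    homEval 0 (linP p m ⊗ q) m p ≡⟨ homEval-zero (linP p m ⊗ q) ⟩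
    (linP p m ⊗ q) 0             ≡⟨ linP⊗-zero q ⟩
    - m * q 0                    ≡⟨ regroup m (q 0) ⟩
    - (m * 1ℤ * q 0)             ∎
    where
    regroup : ∀ m x → - m * x ≡ - (m * 1ℤ * x)
    regroup = solve-∀
  homEval-linP⊗ (suc n) q = begin
    homEval (suc n) (linP p m ⊗ q) m p
      ≡⟨ homEval-suc n (linP p m ⊗ q) ⟩
    p * homEval n (linP p m ⊗ q) m p + (linP p m ⊗ q) (suc n) * m ^ suc n
      ≡⟨ cong₂ (λ x y → p * x + y * m ^ suc n) (homEval-linP⊗ n q) (linP⊗-suc q n) ⟩
    p * - (m ^ suc n * q n) + (- m * q (suc n) + p * q n) * m ^ suc n
      ≡⟨ telescope p m (m ^ n) (q n) (q (suc n)) ⟩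
    - (m ^ suc (suc n) * q (suc n))
      ∎
    where
    telescope : ∀ p m mⁿ x y → p * - (m * mⁿ * x) + (- m * y + p * x) * (m * mⁿ) ≡ - (m * (m * mⁿ) * y)
    telescope = solve-∀

  linP⊗truncP-≥ : ∀ D q n → D < n → (linP p m ⊗ truncP D q) n ≡ 0ℤ
  linP⊗truncP-≥ D q (suc n) (s≤s D≤n) = begin
    (linP p m ⊗ truncP D q) (suc n)                    ≡⟨ linP⊗-suc (truncP D q) n ⟩
    - m * truncP D q (suc n) + p * truncP D q n
      ≡⟨ cong₂ (λ x y → - m * x + p * y) (truncP-≥ D q (suc n) (ℕP.m≤n⇒m≤1+n D≤n)) (truncP-≥ D q n D≤n) ⟩
    - m * 0ℤ + p * 0ℤ                                  ≡⟨ vanish m p ⟩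
    0ℤ                                                 ∎
    where
    vanish : ∀ m p → - m * 0ℤ + p * 0ℤ ≡ 0ℤ
    vanish = solve-∀

  homEval≡0⇒linP-factor : Comaximal m p → m ≢ 0ℤ → ∀ D w →
                          (∀ i → D < i → w i ≡ 0ℤ) → homEval D w m p ≡ 0ℤ →
                          ∃ λ q → w ≈P (linP p m ⊗ truncP D q)
  homEval≡0⇒linP-factor coprime m≢0 D w w-deg root = q , coefficients
    where
    divisible : ∀ n → n ≤ D → m ^ suc n ∣ homEval n w m p
    divisible n n≤D = descend (D ∸ n) n (ℕP.m∸n+n≡m n≤D)
      where
      descend : ∀ s n → s ℕ.+ n ≡ D → m ^ suc n ∣ homEval n w m p
      descend zero    n refl  = divides 0ℤ root
      descend (suc s) n s+n≡D = comaximal-divisor (comaximal-^ coprime (suc n))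
        (∣m+n∣n⇒∣m (subst (m ^ suc n ∣_) (homEval-suc n w) (∣-trans (∣n⇒∣m*n m ∣-refl) above))
                   (∣n⇒∣m*n (w (suc n)) ∣-refl))
        where
        above : m ^ suc (suc n) ∣ homEval (suc n) w m p
        above = descend s (suc n) (trans (ℕP.+-suc s n) s+n≡D)

    q : ℕ → ℤ
    q n with n ℕ.≤? D
    ... | yes n≤D = - quotient (divisible n n≤D)
    ... | no  _   = 0ℤ

    q-spec : ∀ n → n ≤ D → homEval n w m p ≡ - (m ^ suc n * q n)
    q-spec n n≤D with n ℕ.≤? D
    ... | no n≰D = contradiction n≤D n≰D
    ... | yes n≤D′ with divisible n n≤D′
    ...   | divides Q H≡Qmⁿ⁺¹ = trans H≡Qmⁿ⁺¹ (negate Q (m ^ suc n))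
      where
      negate : ∀ Q M → Q * M ≡ - (M * - Q)
      negate = solve-∀

    agree : ∀ n → n ≤ D → homEval n w m p ≡ homEval n (linP p m ⊗ truncP D q) m p
    agree n n≤D with ℕP.m≤n⇒m<n∨m≡n n≤D
    ... | inj₁ n<D = begin
      homEval n w m p                          ≡⟨ q-spec n n≤D ⟩
      - (m ^ suc n * q n)                      ≡⟨ cong (λ x → - (m ^ suc n * x)) (truncP-< D q n n<D) ⟨
      - (m ^ suc n * truncP D q n)             ≡⟨ homEval-linP⊗ n (truncP D q) ⟨
      homEval n (linP p m ⊗ truncP D q) m p    ∎
    ... | inj₂ refl = begin
      homEval n w m p                          ≡⟨ root ⟩
      0ℤ                                       ≡⟨ vanish (m ^ suc n) ⟨
      - (m ^ suc n * 0ℤ)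
        ≡⟨ cong (λ x → - (m ^ suc n * x)) (truncP-≥ n q n ℕP.≤-refl) ⟨
      - (m ^ suc n * truncP n q n)             ≡⟨ homEval-linP⊗ n (truncP n q) ⟨
      homEval n (linP p m ⊗ truncP n q) m p    ∎
      where
      vanish : ∀ M → - (M * 0ℤ) ≡ 0ℤ
      vanish = solve-∀

    coefficients : w ≈P (linP p m ⊗ truncP D q)
    coefficients n with n ℕ.≤? D
    ... | yes n≤D = homEval-injective m≢0 {D} {w} {linP p m ⊗ truncP D q} agree n n≤D
    ... | no  n≰D = trans (w-deg n (ℕP.≰⇒> n≰D)) (sym (linP⊗truncP-≥ D q n (ℕP.≰⇒> n≰D)))

module Pairing (a p m cd : ℤ) (D : ℕ) where

  open HomogeneousEvaluation m p
  open ≡-Reasoning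

  pairing : Poly → ℤ
  pairing g = a * homEval D g m p + g (suc D) * cd

  Σ<-cVec : ∀ g → Σ< (suc (suc D)) (λ i → g i * cVec (suc D) a p m cd i) ≡ pairing g
  Σ<-cVec g = cong₂ _+_ lower top
    where
    rearrange : ∀ g a P M → g * (a * P * M) ≡ a * (g * M * P)
    rearrange = solve-∀
    below : ∀ i → i < suc D → g i * cVec (suc D) a p m cd i ≡ a * (g i * m ^ i * p ^ (D ∸ i))
    below i i<d with i ℕ.≡ᵇ suc D | ≡ᵇ-reflects-≡ i (suc D)
    ... | true  | ofʸ i≡d = contradiction i≡d (ℕP.<⇒≢ i<d)
    ... | false | _       = rearrange (g i) a (p ^ (D ∸ i)) (m ^ i)
    lower : Σ< (suc D) (λ i → g i * cVec (suc D) a p m cd i) ≡ a * homEval D g m p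
    lower = trans (Σ<-cong (suc D) below) (Σ<-distribˡ (suc D) a _)
    top : g (suc D) * cVec (suc D) a p m cd (suc D) ≡ g (suc D) * cd
    top with suc D ℕ.≡ᵇ suc D | ≡ᵇ-reflects-≡ (suc D) (suc D)
    ... | true  | _       = refl
    ... | false | ofⁿ d≢d = contradiction refl d≢d

  pairing-cong : ∀ {f g} → f ≈P g → pairing f ≡ pairing g
  pairing-cong {f} {g} f≈g = cong₂ (λ x y → a * x + y * cd) (homEval-cong D f≈g) (f≈g (suc D))

  pairing-linear : ∀ c f g → pairing ((c ·P f) ⊕ g) ≡ c * pairing f + pairing g
  pairing-linear c f g = begin
    a * homEval D ((c ·P f) ⊕ g) m p + (c * f (suc D) + g (suc D)) * cd
      ≡⟨ cong (λ x → a * x + (c * f (suc D) + g (suc D)) * cd) (homEval-linear D c f g) ⟩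
    a * (c * homEval D f m p + homEval D g m p) + (c * f (suc D) + g (suc D)) * cd
      ≡⟨ regroup a c (homEval D f m p) (homEval D g m p) (f (suc D)) (g (suc D)) cd ⟩
    c * pairing f + pairing g
      ∎
    where
    regroup : ∀ a c x y u v w → a * (c * x + y) + (c * u + v) * w ≡ c * (a * x + u * w) + (a * y + v * w)
    regroup = solve-∀

  pairing-linP⊗ : ∀ q → pairing (linP p m ⊗ truncP D q) ≡ 0ℤ
  pairing-linP⊗ q = begin
    a * homEval D (linP p m ⊗ truncP D q) m p + (linP p m ⊗ truncP D q) (suc D) * cd
      ≡⟨ cong₂ (λ x y → a * x + y * cd) (homEval-linP⊗ D (truncP D q))
                                        (linP⊗truncP-≥ D q (suc D) (ℕP.n<1+n D)) ⟩
    a * - (m ^ suc D * truncP D q D) + 0ℤ * cd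
      ≡⟨ cong (λ x → a * - (m ^ suc D * x) + 0ℤ * cd) (truncP-≥ D q D ℕP.≤-refl) ⟩
    a * - (m ^ suc D * 0ℤ) + 0ℤ * cd
      ≡⟨ vanish a (m ^ suc D) cd ⟩
    0ℤ
      ∎
    where
    vanish : ∀ a M cd → a * - (M * 0ℤ) + 0ℤ * cd ≡ 0ℤ
    vanish = solve-∀

  pairing-f̃≡0 : ∀ {k N g ã k̃ f} → p ≢ 0ℤ → p * cd ≡ a * m ^ suc D - k * N →
                g * ã ≡ a → g * k̃ ≡ k → f (suc D) ≡ ã → homEval (suc D) f m p ≡ k̃ * N →
                pairing f ≡ 0ℤ
  pairing-f̃≡0 {k} {N} {g} {ã} {k̃} {f} p≢0 pcd gã gk̃ f-lead f-value =
    ℤP.*-cancelˡ-≡ p _ _ {{≢-nonZero p≢0}} (begin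
      p * (a * H + f (suc D) * cd)          ≡⟨ cong (λ x → p * (a * H + x * cd)) f-lead ⟩
      p * (a * H + ã * cd)                  ≡⟨ expand p a H ã cd M ⟩
      a * (p * H + ã * M) + ã * (p * cd) - a * ã * M
        ≡⟨ cong₂ (λ x y → a * x + ã * y - a * ã * M) value pcd ⟩
      a * (k̃ * N) + ã * (a * M - k * N) - a * ã * M
        ≡⟨ cong₂ (λ x y → x * (k̃ * N) + ã * (x * M - y * N) - x * ã * M) gã gk̃ ⟨
      g * ã * (k̃ * N) + ã * (g * ã * M - g * k̃ * N) - g * ã * ã * M
        ≡⟨ cancel g ã k̃ N M ⟩
      0ℤ                                    ≡⟨ ℤP.*-zeroʳ p ⟨
      p * 0ℤ                                ∎)
    where
    H = homEval D f m p
    M = m ^ suc D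
    value : p * H + ã * M ≡ k̃ * N
    value = trans (cong (λ x → p * H + x * M) (sym f-lead)) (trans (sym (homEval-suc D f)) f-value)
    expand : ∀ p a H ã cd M → p * (a * H + ã * cd) ≡ a * (p * H + ã * M) + ã * (p * cd) - a * ã * M
    expand = solve-∀
    cancel : ∀ g ã k̃ N M → g * ã * (k̃ * N) + ã * (g * ã * M - g * k̃ * N) - g * ã * ã * M ≡ 0ℤ
    cancel = solve-∀

  pairing-combination≡0 : ∀ c f g → pairing f ≡ 0ℤ → pairing g ≡ 0ℤ → pairing ((c ·P f) ⊕ g) ≡ 0ℤ
  pairing-combination≡0 c f g f⊥c g⊥c = begin
    pairing ((c ·P f) ⊕ g)    ≡⟨ pairing-linear c f g ⟩
    c * pairing f + pairing g ≡⟨ cong₂ (λ x y → c * x + y) f⊥c g⊥c ⟩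
    c * 0ℤ + 0ℤ               ≡⟨ vanish c ⟩
    0ℤ                        ∎
    where
    vanish : ∀ c → c * 0ℤ + 0ℤ ≡ 0ℤ
    vanish = solve-∀

  pairing≡0⇒root : a ≢ 0ℤ → ∀ {w} → w (suc D) ≡ 0ℤ → pairing w ≡ 0ℤ → homEval D w m p ≡ 0ℤ
  pairing≡0⇒root a≢0 {w} w-lead w⊥c = ℤP.*-cancelˡ-≡ a (homEval D w m p) 0ℤ {{≢-nonZero a≢0}} (begin
    a * homEval D w m p             ≡⟨ ℤP.+-identityʳ (a * homEval D w m p) ⟨
    a * homEval D w m p + 0ℤ * cd   ≡⟨ cong (λ x → a * homEval D w m p + x * cd) w-lead ⟨
    pairing w                       ≡⟨ w⊥c ⟩
    0ℤ                              ≡⟨ ℤP.*-zeroʳ a ⟨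
    a * 0ℤ                          ∎)

  pairing-kernel-factor : Comaximal m p → m ≢ 0ℤ → a ≢ 0ℤ → ∀ {w} →
                          (∀ i → D < i → w i ≡ 0ℤ) → pairing w ≡ 0ℤ →
                          ∃ λ q → w ≈P (linP p m ⊗ truncP D q)
  pairing-kernel-factor coprime m≢0 a≢0 {w} w-deg w⊥c =
    homEval≡0⇒linP-factor coprime m≢0 D w w-deg (pairing≡0⇒root a≢0 {w} (w-deg (suc D) (ℕP.n<1+n D)) w⊥c)

  span⇒pairing≡0 : ∀ {f} → pairing f ≡ 0ℤ → ∀ {V} r →
                   V ≈P ((r D ·P f) ⊕ (linP p m ⊗ truncP D r)) → pairing V ≡ 0ℤ
  span⇒pairing≡0 {f} f⊥c {V} r V≈ =
    trans (pairing-cong V≈) (pairing-combination≡0 (r D) f (linP p m ⊗ truncP D r) f⊥c (pairing-linP⊗ r))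

  pairing≡0⇒span : Comaximal m p → m ≢ 0ℤ → a ≢ 0ℤ →
                   ∀ {ã f} → DegLead (suc D) ã f → pairing f ≡ 0ℤ →
                   ∀ {V} → (∀ i → suc D < i → V i ≡ 0ℤ) → pairing V ≡ 0ℤ →
                   ∀ ρ → V (suc D) ≡ ρ * ã →
                   ∃ λ r → V ≈P ((r D ·P f) ⊕ (linP p m ⊗ truncP D r))
  pairing≡0⇒span coprime m≢0 a≢0 {ã} {f} (f-lead , f-deg) f⊥c {V} V-deg V⊥c ρ V-lead = r , V≈
    where
    remainder-deg : ∀ i → D < i → (((- ρ) ·P f) ⊕ V) i ≡ 0ℤ
    remainder-deg i D<i with ℕP.m≤n⇒m<n∨m≡n D<i
    ... | inj₂ refl = trans (cong₂ (λ x y → - ρ * x + y) f-lead V-lead) (opposite ρ ã)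
      where
      opposite : ∀ ρ ã → - ρ * ã + ρ * ã ≡ 0ℤ
      opposite = solve-∀
    ... | inj₁ d<i  = trans (cong₂ (λ x y → - ρ * x + y) (f-deg i d<i) (V-deg i d<i)) (vanish ρ)
      where
      vanish : ∀ ρ → - ρ * 0ℤ + 0ℤ ≡ 0ℤ
      vanish = solve-∀

    remainder⊥c : pairing (((- ρ) ·P f) ⊕ V) ≡ 0ℤ
    remainder⊥c = pairing-combination≡0 (- ρ) f V f⊥c V⊥c

    factor : ∃ λ q → (((- ρ) ·P f) ⊕ V) ≈P (linP p m ⊗ truncP D q)
    factor = pairing-kernel-factor coprime m≢0 a≢0 remainder-deg remainder⊥c

    q : ℕ → ℤ
    q = proj₁ factor

    r : ℕ → ℤ
    r = withTop D q ρ

    V≈ : V ≈P ((r D ·P f) ⊕ (linP p m ⊗ truncP D r))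
    V≈ i = begin
      V i                                      ≡⟨ split ρ (f i) (V i) ⟩
      ρ * f i + (- ρ * f i + V i)
        ≡⟨ cong₂ (λ x y → x * f i + y) (sym (withTop-top D q ρ)) (proj₂ factor i) ⟩
      r D * f i + (linP p m ⊗ truncP D q) i
        ≡⟨ cong (λ y → r D * f i + y) (⊗-congʳ (linP p m) (truncP-withTop D q ρ) i) ⟨
      r D * f i + (linP p m ⊗ truncP D r) i    ∎
      where
      split : ∀ ρ x v → v ≡ ρ * x + (- ρ * x + v)
      split = solve-∀

  orthogonal⇔span : ∀ {k} N ã k̃ c̃ → a ≢ 0ℤ → p ≢ 0ℤ → m ≢ 0ℤ → Comaximal m p →
                    p * cd ≡ a * m ^ suc D - k * N →
                    gcd a cd * ã ≡ a → gcd a cd * k̃ ≡ k → gcd a cd * c̃ ≡ cd →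
                    ∀ f → DegLead (suc D) ã f → homEval (suc D) f m p ≡ k̃ * N → ∀ v →
                    Orthogonal (suc D) v (cVec (suc D) a p m cd)
                      ⇔ ∃ λ r → vecP v ≈P ((r D ·P f) ⊕ (linP p m ⊗ truncP D r))
  orthogonal⇔span {k} N ã k̃ c̃ a≢0 p≢0 m≢0 m⊥p pcd gã gk̃ gc̃ f f-deg f-value v = mk⇔
    (λ v⊥c → let ã∣v = ã∣v-top (v⊥c⇒pairing≡0 v⊥c) in
      pairing≡0⇒span m⊥p m≢0 a≢0 f-deg f⊥c (vecP-≥ v) (v⊥c⇒pairing≡0 v⊥c)
                     (quotient ã∣v) (_∣_.equality ã∣v))
    (λ (r , v≈) → trans (Σ<-cVec (vecP v)) (span⇒pairing≡0 f⊥c r v≈))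
    where
    g≢0 : gcd a cd ≢ 0ℤ
    g≢0 g≡0 = a≢0 (gcd[i,j]≡0⇒i≡0 a cd g≡0)
    f⊥c : pairing f ≡ 0ℤ
    f⊥c = pairing-f̃≡0 {k} {N} {gcd a cd} {ã} {k̃} {f} p≢0 pcd gã gk̃ (proj₁ f-deg) f-value
    v⊥c⇒pairing≡0 : Orthogonal (suc D) v (cVec (suc D) a p m cd) → pairing (vecP v) ≡ 0ℤ
    v⊥c⇒pairing≡0 = trans (sym (Σ<-cVec (vecP v)))
    ã∣v-top : pairing (vecP v) ≡ 0ℤ → ã ∣ vecP v (suc D)
    ã∣v-top = comaximal-cofactor-∣ ã c̃ (homEval D (vecP v) m p) (vecP v (suc D)) g≢0 gã gc̃
                (cofactors-comaximal ã c̃ g≢0 gã gc̃)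

-1≤2t<1⇒t≡0 : ∀ {t} → - (+ 1) ℤ.≤ + 2 * t → + 2 * t ℤ.< + 1 → t ≡ 0ℤ
-1≤2t<1⇒t≡0 {+ zero}   _         _                 = refl
-1≤2t<1⇒t≡0 {+[1+ n ]} _         (+<+ (s≤s ()))
-1≤2t<1⇒t≡0 { -[1+ n ]} (-≤- 2n+1≤0) _ = contradiction (ℕP.m+n≤o⇒n≤o n 2n+1≤0) λ ()

step1-j≡n : ∀ {p K x} n (G : ℕ → ℤ) → n ≡ 0 → p ^ n * x ≡ K - Σ< n G ⇔ x ≡ K
step1-j≡n {p} {K} {x} .0 G refl = mk⇔
  (λ eq → trans (sym (ℤP.*-identityˡ x)) (trans eq (ℤP.+-identityʳ K)))
  (λ x≡K → trans (ℤP.*-identityˡ x) (trans x≡K (sym (ℤP.+-identityʳ K))))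

module _ {m p K : ℤ} {d : ℕ} {c : ℤ} where

  open HomogeneousEvaluation m p

  AlgARun-correct : 0 < d → (run : AlgARun m p K d d (λ _ → c)) →
                    DegLead d c (AlgARun.out run) × homEval d (AlgARun.out run) m p ≡ K
  AlgARun-correct 0<d run = (out-pre d ℕP.≤-refl ℕP.≤-refl , out-high) , trans (partial d ℕP.≤-refl) top
    where
    open AlgARun run
    open ≡-Reasoning

    partial : ∀ i → i ≤ d → homEval i out m p ≡ r i
    partial zero _ = begin
      homEval 0 out m p ≡⟨ homEval-zero out ⟩
      out 0             ≡⟨ ℤP.*-identityˡ (out 0) ⟨
      1ℤ * out 0        ≡⟨ step2-a 0 0<d ⟩
      r 0 + t 0 * p     ≡⟨ cong (λ x → r 0 + x * p) (-1≤2t<1⇒t≡0 (step2-tlo 0 0<d) (step2-thi 0 0<d)) ⟩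
      r 0 + 0ℤ          ≡⟨ ℤP.+-identityʳ (r 0) ⟩
      r 0               ∎
    partial (suc i) i<d = begin
      homEval (suc i) out m p                                   ≡⟨ homEval-suc i out ⟩
      p * homEval i out m p + out (suc i) * m ^ suc i
        ≡⟨ cong (λ x → p * x + out (suc i) * m ^ suc i) (partial i (ℕP.<⇒≤ i<d)) ⟩
      p * r i + out (suc i) * m ^ suc i
        ≡⟨ cong (_+ out (suc i) * m ^ suc i) (step2-r i i<d) ⟩
      r (suc i) - out (suc i) * m ^ suc i + out (suc i) * m ^ suc i
        ≡⟨ cancel (r (suc i)) (out (suc i) * m ^ suc i) ⟩
      r (suc i)                                                 ∎
      where
      cancel : ∀ x y → x - y + y ≡ x
      cancel = solve-∀

    top : r d ≡ K
    top = Equivalence.to (step1-j≡n (d ∸ d) _ (ℕP.n∸n≡0 d)) step1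

module AlgARunConstruction
  (m p K c X : ℤ) (d : ℕ) (pX≡K-cmᵈ : p * X ≡ K - c * m ^ d)
  (solution : ∀ i x → ∃ λ t → Balanced (m ^ i) t × m ^ i ∣ x + t * p)
  where

  open ≡-Reasoning

  T : ℕ → ℤ → ℤ
  T i x = proj₁ (solution i x)

  -- R s is the remainder r_(d-s). Below r_(d-1) = X the recursion of step (2) reads
  -- r_i = -t_(i+1), because a_(i+1) m^(i+1) = r_(i+1) + t_(i+1) p.
  R : ℕ → ℤ
  R zero          = K
  R (suc zero)    = X
  R (suc (suc s)) = - T (d ∸ suc s) (R (suc s))

  rem tr quo out : ℕ → ℤ
  rem i = R (d ∸ i)
  tr i  = T i (rem i)
  quo i = quotient (proj₂ (proj₂ (solution i (rem i))))
  out   = truncP (suc d) (withTop d quo c)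

  quo-spec : ∀ i → rem i + tr i * p ≡ quo i * m ^ i
  quo-spec i = _∣_.equality (proj₂ (proj₂ (solution i (rem i))))

  out-< : ∀ i → i < d → out i ≡ quo i
  out-< i i<d = trans (truncP-< (suc d) (withTop d quo c) i (ℕP.m<n⇒m<1+n i<d)) (withTop-< d quo c i i<d)

  out-top : out d ≡ c
  out-top = trans (truncP-< (suc d) (withTop d quo c) d (ℕP.n<1+n d)) (withTop-top d quo c)

  rem-top : rem d ≡ K
  rem-top = cong R (ℕP.n∸n≡0 d)

  rem-last : ∀ i → suc i ≡ d → rem i ≡ X
  rem-last i i+1≡d = cong R (trans (cong (_∸ i) (sym i+1≡d)) (ℕP.m+n∸n≡m 1 i))

  rem-step : ∀ i → suc i < d → rem i ≡ - tr (suc i)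
  rem-step i i+1<d = begin
    R (d ∸ i)                   ≡⟨ cong R (trans (ℕP.+-∸-assoc 1 (ℕP.<⇒≤ i+1<d)) (cong suc gap)) ⟩
    R (suc (suc s))             ≡⟨⟩
    - T (d ∸ suc s) (R (suc s)) ≡⟨ cong₂ (λ j x → - T j x) top-index (cong R (sym gap)) ⟩
    - T (suc i) (R (d ∸ suc i)) ∎
    where
    s = d ∸ suc (suc i)
    gap : d ∸ suc i ≡ suc s
    gap = ℕP.+-∸-assoc 1 i+1<d
    top-index : d ∸ suc s ≡ suc i
    top-index = trans (cong (d ∸_) (sym gap)) (ℕP.m∸[m∸n]≡n (ℕP.<⇒≤ i+1<d))

  step2-r : ∀ i → i < d → p * rem i ≡ rem (suc i) - out (suc i) * m ^ suc i
  step2-r i i<d with ℕP.m≤n⇒m<n∨m≡n i<d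
  ... | inj₁ i+1<d = begin
    p * rem i                                 ≡⟨ cong (p *_) (rem-step i i+1<d) ⟩
    p * - tr (suc i)                          ≡⟨ isolate p (tr (suc i)) (rem (suc i)) ⟩
    rem (suc i) - (rem (suc i) + tr (suc i) * p) ≡⟨ cong (λ x → rem (suc i) - x) (quo-spec (suc i)) ⟩
    rem (suc i) - quo (suc i) * m ^ suc i
      ≡⟨ cong (λ x → rem (suc i) - x * m ^ suc i) (out-< (suc i) i+1<d) ⟨
    rem (suc i) - out (suc i) * m ^ suc i     ∎
    where
    isolate : ∀ p t x → p * - t ≡ x - (x + t * p)
    isolate = solve-∀
  ... | inj₂ i+1≡d = begin
    p * rem i                                 ≡⟨ cong (p *_) (rem-last i i+1≡d) ⟩
    p * X                                     ≡⟨ pX≡K-cmᵈ ⟩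
    K - c * m ^ d                             ≡⟨ cong₂ _-_ K≡rem c*mᵈ≡ ⟩
    rem (suc i) - out (suc i) * m ^ suc i     ∎
    where
    K≡rem : K ≡ rem (suc i)
    K≡rem = trans (sym rem-top) (cong rem (sym i+1≡d))
    c*mᵈ≡ : c * m ^ d ≡ out (suc i) * m ^ suc i
    c*mᵈ≡ = cong₂ _*_ (trans (sym out-top) (cong out (sym i+1≡d))) (cong (m ^_) (sym i+1≡d))

  run : AlgARun m p K d d (λ _ → c)
  run = record
    { r         = rem
    ; t         = tr
    ; out       = out
    ; out-pre   = λ i d≤i i≤d → subst (λ j → out j ≡ c) (ℕP.≤-antisym d≤i i≤d) out-top
    ; out-high  = λ i d<i → truncP-≥ (suc d) (withTop d quo c) i d<i
    ; step1     = Equivalence.from (step1-j≡n (d ∸ d) _ (ℕP.n∸n≡0 d)) rem-top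
    ; step2-r   = step2-r
    ; step2-tlo = λ i _ → proj₁ (proj₁ (proj₂ (solution i (rem i))))
    ; step2-thi = λ i _ → proj₂ (proj₁ (proj₂ (solution i (rem i))))
    ; step2-tcg = λ i _ → ∣⇒∣ᵤ (proj₂ (proj₂ (solution i (rem i))))
    ; step2-a   = λ i i<d → trans (cong (m ^ i *_) (out-< i i<d))
                                  (trans (ℤP.*-comm (m ^ i) (quo i)) (sym (quo-spec i)))
    }

lemma4p2 : (N d : ℕ) (a p m k : ℤ) →
  0 < N → 2 ≤ d →
  a ≢ + 0 → p ≢ + 0 → m ≢ + 0 → k ≢ + 0 →
  gcd m p ≡ + 1 → gcd (a * p) (+ N) ≡ + 1 →
  (cd : ℤ) → p * cd ≡ a * m ^ d - k * + N → cd ≢ + 0 →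
  (ã k̃ : ℤ) → gcd a cd * ã ≡ a → gcd a cd * k̃ ≡ k →
  ((f : Poly) → DegLead d ã f → homEval d f m p ≡ k̃ * + N →
     (v : Fin (Data.Nat.suc d) → ℤ) →
     Orthogonal d v (cVec d a p m cd)
       ⇔ ∃ λ (r : ℕ → ℤ) →
           vecP v ≈P ((r (d Data.Nat.∸ 1) ·P f)
                      ⊕ (linP p m ⊗ truncP (d Data.Nat.∸ 1) r)))
  × (∃ λ (f : Poly) → DegLead d ã f × homEval d f m p ≡ k̃ * + N)
  × AlgARun m p (k̃ * + N) d d (λ _ → ã)
  × ((run : AlgARun m p (k̃ * + N) d d (λ _ → ã)) →
       DegLead d ã (AlgARun.out run)
       × homEval d (AlgARun.out run) m p ≡ k̃ * + N)
lemma4p2 N .(suc D) a p m k _ (s≤s {n = D} _) a≢0 p≢0 m≢0 _ gcd[m,p]≡1 _ cd pcd _ ã k̃ gã gk̃ =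
  Pairing.orthogonal⇔span a p m cd D (+ N) ã k̃ c̃ a≢0 p≢0 m≢0 m⊥p pcd gã gk̃ gc̃ ,
  (AlgARun.out run , AlgARun-correct 0<d run) , run , AlgARun-correct 0<d
  where
  0<d : 0 < suc D
  0<d = s≤s z≤n
  m⊥p : Comaximal m p
  m⊥p = gcd≡1⇒comaximal gcd[m,p]≡1
  c̃ : ℤ
  c̃ = proj₁ (gcd-cofactorʳ a cd)
  gc̃ : gcd a cd * c̃ ≡ cd
  gc̃ = proj₂ (gcd-cofactorʳ a cd)
  -- Step (1) of Algorithm A sets r_(d-1) = (k̃N - ã m^d) / p, which is -c̃.
  run : AlgARun m p (k̃ * + N) (suc D) (suc D) (λ _ → ã)
  run = AlgARunConstruction.run m p (k̃ * + N) ã (- c̃) (suc D)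
          (divide-common-factor p c̃ ã k̃ (m ^ suc D) (+ N) (a≢0 ∘ gcd[i,j]≡0⇒i≡0 a cd) gc̃ gã gk̃ pcd)
          (λ i → comaximal-balanced-solve (comaximal-^ m⊥p i) (^≢0 m≢0 i))
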